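{- Let $p<q<r$ be primes. There is no small recurrent integer $N>1$ such that the four smallest elements of $S'_N$ are $p<q<r<pq$.
   Context: $S'_N=\{d:1<d<\sqrt N,\ d\mid N\}$. $N$ is small recurrent if there are integers $a,b$ such that the elements $x_1<x_2<\cdots$ of $S'_N$ satisfy $x_i=ax_{i-1}+bx_{i-2}$ for all $i\ge3$ (vacuously true if $|S'_N|\le2$). -}

module Defs where

open import Data.Nat using (ℕ; _*_; _<_; _<?_)
open import Data.Nat.Divisibility using (_∣_; _∣?_)
open import Data.List using (List; []; _∷_; filter; upTo)
open import Data.Product using (_×_; ∃; ∃-syntax)
open import Data.Unit using (⊤)
open import Data.Integer as ℤ using (ℤ; +_)
open import Relation.Nullary.Decidable using (_×-dec_)
open import Relation.Binary.PropositionalEquality using (_≡_)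

-- d is in S'_N  iff  1 < d, d < √N (i.e. d*d < N for naturals), and d ∣ N
InS' : ℕ → ℕ → Set
InS' N d = (1 < d) × (d * d < N) × (d ∣ N)

-- S'_N as an increasing list (every such d is < N, so searching upTo N suffices)
S' : ℕ → List ℕ
S' N = filter (λ d → (1 <? d) ×-dec ((d * d <? N) ×-dec (d ∣? N))) (upTo N)

RecurrentList : ℤ → ℤ → List ℕ → Set
RecurrentList a b (x ∷ y ∷ z ∷ rest) =
  ((+ z) ≡ (a ℤ.* (+ y)) ℤ.+ (b ℤ.* (+ x))) × RecurrentList a b (y ∷ z ∷ rest)
RecurrentList a b _ = ⊤

SmallRecurrent : ℕ → Set
SmallRecurrent N = ∃[ a ] ∃[ b ] RecurrentList a b (S' N)

module Submission where

-- Write the recurrence at p, q, r, pq as r = aq + bp and pq = ar + bq. As q divides ar but not r,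
-- a = Aq; then b = p − Ar and r − p² = A(q² − pr). The next element x₅ = a·pq + b·r satisfies
-- x₅ − pr = (pr − q²)·A(Ar − p) with A(Ar − p) > 0 (A = 0 would give r = p²), so x₅ ≠ pr, and
-- x₅ > pr whenever q² < pr. Hence S'_N has no element m with q² ≤ m ≤ pr: it would give q² < pr
-- and x₅ ≤ m ≤ pr.
-- But such an element exists. A multiple of q in S'_N beyond pq is at least q², since its cofactor
-- is an element of S'_N larger than p. If pr ∈ S'_N then x₅ < pr, so the element after x₅, a
-- multiple of q by the recurrence, lies in [q², pr]. Otherwise N ≤ (pr)², and as pqr ∣ N this
-- forces N = Mq·pr with q ≤ M (M = p would put p² into S'_N), so Mq lies in [q², pr].

module IntegerRecurrence where

  open import Data.Nat.Base as ℕ using (ℕ; z≤n; s≤s)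
  import Data.Nat.Properties as ℕₚ
  import Data.Nat.Divisibility as ℕ
  open import Data.Nat.Primality using (Prime; euclidsLemma; prime⇒nonZero)
  open import Data.Integer.Base
    using (ℤ; +_; +[1+_]; -[1+_]; 0ℤ; 1ℤ; _+_; _-_; _*_; -_; _<_; _≤_; ∣_∣; +<+; +≤+; NonZero; positive)
  open import Data.Integer.Properties
  open import Data.Integer.Divisibility.Signed using (_∣_; divides; ∣ᵤ⇒∣; ∣⇒∣ᵤ)
  open import Data.Integer.Tactic.RingSolver using (solve)
  open import Data.List.Base using ([]; _∷_)
  open import Data.Sum.Base using (inj₁; inj₂)
  open import Relation.Nullary.Negation using (¬_; contradiction)
  open import Relation.Binary.PropositionalEquality
  open ≡-Reasoning

  i<j⇒0<j-i : ∀ {i j} → i < j → 0ℤ < j - i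
  i<j⇒0<j-i {i} {j} i<j = subst (_< j - i) (+-inverseʳ i) (+-monoˡ-< (- i) i<j)

  0<A*[A*n-m] : ∀ A {m n} → A ≢ 0ℤ → m ℕ.< n → 0ℤ < A * (A * + n - + m)
  0<A*[A*n-m] (+ 0) A≢0 _ = contradiction refl A≢0
  0<A*[A*n-m] A@(+[1+ _ ]) {m} {n} _ m<n =
    subst (_< A * (A * + n - + m)) (*-zeroʳ A) (*-monoˡ-<-pos A (i<j⇒0<j-i (<-≤-trans (+<+ m<n) n≤A*n)))
    where
    n≤A*n : + n ≤ A * + n
    n≤A*n = subst (_≤ A * + n) (*-identityˡ (+ n)) (*-monoʳ-≤-nonNeg (+ n) {1ℤ} {A} (+≤+ (s≤s z≤n)))
  0<A*[A*n-m] A@(-[1+ _ ]) {m} {n} _ m<n =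
    subst (_< A * (A * + n - + m)) (*-zeroʳ A) (*-monoˡ-<-neg A (≤-<-trans (i-j≤i (A * + n) (+ m)) A*n<0))
    where
    A*n<0 : A * + n < 0ℤ
    A*n<0 = subst (A * + n <_) (*-zeroʳ A) (*-monoˡ-<-neg A (+<+ (ℕₚ.≤-<-trans z≤n m<n)))

  i<i+j*k : ∀ i {j k} → 0ℤ < k → 0ℤ < j → i < i + j * k
  i<i+j*k i {j} {k} 0<k 0<j = subst (_< i + j * k) (+-identityʳ i) (+-monoʳ-< i 0<j*k)
    where
    0<j*k : 0ℤ < j * k
    0<j*k = subst (_< j * k) (*-zeroˡ k) (*-monoʳ-<-pos k {{positive 0<k}} 0<j)

  i+j*k≡i⇒j≡0 : ∀ i j {k} → 0ℤ < k → i + j * k ≡ i → j ≡ 0ℤ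
  i+j*k≡i⇒j≡0 i j {k} 0<k eq with i*j≡0⇒i≡0∨j≡0 j j*k≡0
    where
    j*k≡0 : j * k ≡ 0ℤ
    j*k≡0 = begin
      j * k           ≡⟨ solve (i ∷ j ∷ k ∷ []) ⟩
      i + j * k - i   ≡⟨ cong (_- i) eq ⟩
      i - i           ≡⟨ +-inverseʳ i ⟩
      0ℤ              ∎
  ... | inj₁ j≡0 = j≡0
  ... | inj₂ k≡0 = contradiction (subst (0ℤ <_) k≡0 0<k) (<-irrefl refl)

  module Recurrence (P Q R a b : ℤ) (h₁ : R ≡ a * Q + b * P) (h₂ : P * Q ≡ a * R + b * Q) where

    a*R≡[P-b]*Q : a * R ≡ (P - b) * Q
    a*R≡[P-b]*Q = begin
      a * R                  ≡⟨ solve (a ∷ R ∷ b ∷ Q ∷ []) ⟩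
      a * R + b * Q - b * Q  ≡⟨ cong (_- b * Q) (sym h₂) ⟩
      P * Q - b * Q          ≡⟨ solve (P ∷ Q ∷ b ∷ []) ⟩
      (P - b) * Q            ∎

    module Normalised .{{_ : NonZero Q}} (A : ℤ) (a≡A*Q : a ≡ A * Q) where

      b≡P-A*R : b ≡ P - A * R
      b≡P-A*R = *-cancelʳ-≡ b (P - A * R) Q (begin
        b * Q                ≡⟨ solve (P ∷ Q ∷ b ∷ []) ⟩
        P * Q - (P - b) * Q  ≡⟨ cong (λ t → P * Q - t) (trans (sym a*R≡[P-b]*Q) (cong (_* R) a≡A*Q)) ⟩
        P * Q - A * Q * R    ≡⟨ solve (P ∷ Q ∷ R ∷ A ∷ []) ⟩
        (P - A * R) * Q      ∎)

      h₁′ : R ≡ A * Q * Q + (P - A * R) * P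
      h₁′ = trans h₁ (cong₂ (λ a′ b′ → a′ * Q + b′ * P) a≡A*Q b≡P-A*R)

      A≡0⇒R≡P*P : A ≡ 0ℤ → R ≡ P * P
      A≡0⇒R≡P*P A≡0 = trans h₁′ (begin
        A * Q * Q + (P - A * R) * P  ≡⟨ cong (λ t → t * Q * Q + (P - t * R) * P) A≡0 ⟩
        0ℤ * Q * Q + (P - 0ℤ * R) * P ≡⟨ solve (P ∷ Q ∷ R ∷ []) ⟩
        P * P                         ∎)

      -- The two sides differ by A R (A Q Q + (P − A R) P − R), which vanishes by h₁′.
      fifth-term : ∀ {X} → X ≡ a * (P * Q) + b * R → X ≡ P * R + (P * R - Q * Q) * (A * (A * R - P))
      fifth-term {X} h₃ = begin
        X
          ≡⟨ trans h₃ (cong₂ (λ a′ b′ → a′ * (P * Q) + b′ * R) a≡A*Q b≡P-A*R) ⟩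
        A * Q * (P * Q) + (P - A * R) * R
          ≡⟨ solve (P ∷ Q ∷ R ∷ A ∷ []) ⟩
        P * R + (P * R - Q * Q) * (A * (A * R - P)) + A * R * (A * Q * Q + (P - A * R) * P - R)
          ≡⟨ cong (λ t → P * R + (P * R - Q * Q) * (A * (A * R - P)) + A * R * (t - R)) (sym h₁′) ⟩
        P * R + (P * R - Q * Q) * (A * (A * R - P)) + A * R * (R - R)
          ≡⟨ solve (P ∷ Q ∷ R ∷ A ∷ []) ⟩
        P * R + (P * R - Q * Q) * (A * (A * R - P))
          ∎

      sixth-term : ∀ {X Y} → Y ≡ a * X + b * (P * Q) → Y ≡ (A * X + b * P) * Q
      sixth-term {X} {Y} h₄ = begin
        Y                          ≡⟨ trans h₄ (cong (λ a′ → a′ * X + b * (P * Q)) a≡A*Q) ⟩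
        A * Q * X + b * (P * Q)    ≡⟨ solve (P ∷ Q ∷ X ∷ b ∷ A ∷ []) ⟩
        (A * X + b * P) * Q        ∎

  module PrimeRecurrence {p q r : ℕ} (q-prime : Prime q) (q∤r : ¬ q ℕ.∣ r) (p<r : p ℕ.< r)
    (r≢p*p : r ≢ p ℕ.* p) (a b : ℤ)
    (h₁ : + r ≡ a * + q + b * + p) (h₂ : + (p ℕ.* q) ≡ a * + r + b * + q) where

    private
      instance
        q≢0 : NonZero (+ q)
        q≢0 = prime⇒nonZero q-prime

      open Recurrence (+ p) (+ q) (+ r) a b h₁ (trans (sym (pos-* p q)) h₂)

      q∣a : + q ∣ a
      q∣a with euclidsLemma ∣ a ∣ r q-prime q∣∣a∣*r
        where
        q∣∣a∣*r : q ℕ.∣ ∣ a ∣ ℕ.* r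
        q∣∣a∣*r = subst (q ℕ.∣_) (abs-* a (+ r)) (∣⇒∣ᵤ (divides (+ p - b) a*R≡[P-b]*Q))
      ... | inj₁ q∣∣a∣ = ∣ᵤ⇒∣ q∣∣a∣
      ... | inj₂ q∣r = contradiction q∣r q∤r

      A : ℤ
      A = _∣_.quotient q∣a

      open Normalised A (_∣_.equality q∣a)

      c : ℤ
      c = A * (A * + r - + p)

      0<c : 0ℤ < c
      0<c = 0<A*[A*n-m] A A≢0 p<r
        where
        A≢0 : A ≢ 0ℤ
        A≢0 A≡0 = r≢p*p (+-injective (trans (A≡0⇒R≡P*P A≡0) (sym (pos-* p p))))

      fifth-shape : ∀ {x} → + x ≡ a * + (p ℕ.* q) + b * + r →
                    + x ≡ + (p ℕ.* r) + (+ (p ℕ.* r) - + (q ℕ.* q)) * c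
      fifth-shape h₃ = trans
        (fifth-term (trans h₃ (cong (λ t → a * t + b * + r) (pos-* p q))))
        (cong₂ (λ u v → u + (u - v) * c) (sym (pos-* p r)) (sym (pos-* q q)))

    fifth-beyond-pr : ∀ {x} → + x ≡ a * + (p ℕ.* q) + b * + r → q ℕ.* q ℕ.< p ℕ.* r → p ℕ.* r ℕ.< x
    fifth-beyond-pr h₃ q²<pr = drop‿+<+ (subst (+ (p ℕ.* r) <_) (sym (fifth-shape h₃))
      (i<i+j*k (+ (p ℕ.* r)) 0<c (i<j⇒0<j-i (+<+ q²<pr))))

    fifth-≢-pr : ∀ {x} → + x ≡ a * + (p ℕ.* q) + b * + r → q ℕ.* q ≢ p ℕ.* r → x ≢ p ℕ.* r
    fifth-≢-pr h₃ q²≢pr refl = q²≢pr (sym (+-injective (i-j≡0⇒i≡j _ _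
      (i+j*k≡i⇒j≡0 (+ (p ℕ.* r)) (+ (p ℕ.* r) - + (q ℕ.* q)) 0<c (sym (fifth-shape h₃))))))

    sixth-divisible : ∀ {x y} → + y ≡ a * + x + b * + (p ℕ.* q) → q ℕ.∣ y
    sixth-divisible {x} h₄ = ∣⇒∣ᵤ (divides (A * + x + b * + p)
      (sixth-term (trans h₄ (cong (λ t → a * + x + b * t) (pos-* p q)))))

open import Defs
open import Data.Nat using (ℕ; _*_; _<_)
open import Data.Nat.Primality using (Prime)
open import Data.List using (List; _∷_)
open import Data.Product using (_×_; ∃-syntax)
open import Relation.Nullary using (¬_)
open import Relation.Binary.PropositionalEquality using (_≡_)

open import Data.Nat.Base using (suc; _≤_; z≤n; s≤s; NonZero; nonTrivial⇒n>1)
open import Data.Nat.Properties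
open import Data.Nat.Divisibility using (_∣_; _∣?_; divides; ∣-trans; m∣m*n; >⇒∤)
open import Data.Nat.Primality using (euclidsLemma; prime⇒irreducible; prime⇒nonZero; prime⇒nonTrivial)
open import Data.Nat.Tactic.RingSolver using (solve)
open import Data.Integer.Base as ℤ using (+_)
open import Data.List.Base using ([]; upTo)
open import Data.List.Membership.Propositional using (_∈_)
open import Data.List.Membership.Propositional.Properties using (∈-filter⁺; ∈-filter⁻; ∈-upTo⁺)
open import Data.List.Relation.Unary.Any as Any using (here; there)
open import Data.List.Relation.Unary.All as All using ()
open import Data.List.Relation.Unary.AllPairs as AllPairs using (AllPairs; _∷_)
import Data.List.Relation.Unary.AllPairs.Properties as AllPairs
open import Data.Product using (_,_; proj₁; proj₂)
open import Data.Sum using (_⊎_; inj₁; inj₂)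
open import Data.Empty using (⊥)
open import Function using (id; case_of_)
open import Relation.Nullary using (Dec; contradiction)
open import Relation.Nullary.Decidable using (_×-dec_)
open import Relation.Binary.PropositionalEquality using (_≢_; refl; sym; trans; cong; subst)
open IntegerRecurrence

n<n*n : ∀ {n} → 1 < n → n < n * n
n<n*n 1<n@(s≤s (s≤s _)) = m<m*n _ _ 1<n

prime>1 : ∀ {s} → Prime s → 1 < s
prime>1 {s} s-prime = nonTrivial⇒n>1 s {{prime⇒nonTrivial s-prime}}

∤-prime : ∀ {s d} → Prime s → 1 < d → d < s → ¬ d ∣ s
∤-prime s-prime 1<d d<s d∣s with prime⇒irreducible s-prime d∣s
... | inj₁ refl = <-irrefl refl 1<d
... | inj₂ refl = <-irrefl refl d<s

∣-prime-product : ∀ {s m N} → Prime s → s ∣ N → ¬ s ∣ m → m ∣ N → m * s ∣ N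
∣-prime-product {s} {m} s-prime s∣N s∤m (divides k refl) with euclidsLemma k m s-prime s∣N
... | inj₁ (divides j refl) = divides j (solve (j ∷ s ∷ m ∷ []))
... | inj₂ s∣m = contradiction s∣m s∤m

head-≤ : ∀ {x d xs} → AllPairs _<_ (x ∷ xs) → d ∈ x ∷ xs → x ≤ d
head-≤ _ (here refl) = ≤-refl
head-≤ (x<xs ∷ _) (there d∈) = <⇒≤ (All.lookup x<xs d∈)

∈-tail : ∀ {x d xs} → d ∈ x ∷ xs → x < d → d ∈ xs
∈-tail d∈ x<d = Any.tail (>⇒≢ x<d) d∈

next-term-≤ : ∀ {a b y z m xs} → AllPairs _<_ xs → RecurrentList a b (y ∷ z ∷ xs) → m ∈ xs →
              ∃[ x ] (+ x ≡ a ℤ.* + z ℤ.+ b ℤ.* + y) × x ≤ m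
next-term-≤ {xs = _ ∷ _} sorted (h , _) m∈ = _ , h , head-≤ sorted m∈

inS'? : ∀ N d → Dec (InS' N d)
inS'? N d = (1 <? d) ×-dec ((d * d <? N) ×-dec (d ∣? N))

S'-sorted : ∀ N → AllPairs _<_ (S' N)
S'-sorted N = AllPairs.filter⁺ (inS'? N) (AllPairs.applyUpTo⁺₁ id N (λ i<j _ → i<j))

∈S'⇒InS' : ∀ {N d} → d ∈ S' N → InS' N d
∈S'⇒InS' {N} d∈ = proj₂ (∈-filter⁻ (inS'? N) {xs = upTo N} d∈)

InS'⇒∈S' : ∀ {N d} → InS' N d → d ∈ S' N
InS'⇒∈S' {N} d∈@(1<d , d²<N , _) = ∈-filter⁺ (inS'? N) (∈-upTo⁺ (<-trans (n<n*n 1<d) d²<N)) d∈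

InS'-cofactor : ∀ {m n} → 1 < m → m < n → InS' (m * n) m
InS'-cofactor {m} {n} 1<m@(s≤s (s≤s _)) m<n = 1<m , *-monoʳ-< m m<n , divides n (*-comm m n)

module Primes {p q r : ℕ} (p-prime : Prime p) (q-prime : Prime q) (r-prime : Prime r)
  (p<q : p < q) (q<r : q < r) where

  private
    instance
      p≢0 : NonZero p
      p≢0 = prime⇒nonZero p-prime
      q≢0 : NonZero q
      q≢0 = prime⇒nonZero q-prime
      r≢0 : NonZero r
      r≢0 = prime⇒nonZero r-prime

    1<p : 1 < p
    1<p = prime>1 p-prime

    p<r : p < r
    p<r = <-trans p<q q<r

    pq<q² : p * q < q * q
    pq<q² = *-monoˡ-< q p<q

    pq<pr : p * q < p * r
    pq<pr = *-monoʳ-< p q<r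

    q∤r : ¬ q ∣ r
    q∤r = ∤-prime r-prime (prime>1 q-prime) q<r

    q∤pr : ¬ q ∣ p * r
    q∤pr q∣pr with euclidsLemma p r q-prime q∣pr
    ... | inj₁ q∣p = >⇒∤ p<q q∣p
    ... | inj₂ q∣r = q∤r q∣r

    q²≢pr : q * q ≢ p * r
    q²≢pr q²≡pr = q∤pr (divides q (sym q²≡pr))

    r≢p² : r ≢ p * p
    r≢p² r≡p² = ∤-prime r-prime 1<p p<r (divides p r≡p²)

  module Prefix (N : ℕ) {rest} (S'≡ : S' N ≡ p ∷ q ∷ r ∷ p * q ∷ rest) where

    sorted : AllPairs _<_ (p ∷ q ∷ r ∷ p * q ∷ rest)
    sorted = subst (AllPairs _<_) S'≡ (S'-sorted N)

    sorted-from-pq : AllPairs _<_ (p * q ∷ rest)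
    sorted-from-pq = AllPairs.tail (AllPairs.tail (AllPairs.tail sorted))

    rest-sorted : AllPairs _<_ rest
    rest-sorted = AllPairs.tail sorted-from-pq

    ∈-prefix : ∀ {d} → InS' N d → d ∈ p ∷ q ∷ r ∷ p * q ∷ rest
    ∈-prefix {d} d∈ = subst (d ∈_) S'≡ (InS'⇒∈S' d∈)

    prefix⊆S' : ∀ {d} → d ∈ p ∷ q ∷ r ∷ p * q ∷ rest → InS' N d
    prefix⊆S' {d} d∈ = ∈S'⇒InS' (subst (d ∈_) (sym S'≡) d∈)

    rest⊆S' : ∀ {d} → d ∈ rest → InS' N d
    rest⊆S' d∈ = prefix⊆S' (there (there (there (there d∈))))

    r<pq : r < p * q
    r<pq = All.head (AllPairs.head (AllPairs.tail (AllPairs.tail sorted)))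

    rest-above-pq : ∀ {d} → d ∈ rest → p * q < d
    rest-above-pq = All.lookup (AllPairs.head sorted-from-pq)

    [pq]²<N : p * q * (p * q) < N
    [pq]²<N = proj₁ (proj₂ (prefix⊆S' (there (there (there (here refl))))))

    p∣N : p ∣ N
    p∣N = proj₂ (proj₂ (prefix⊆S' (here refl)))

    q∣N : q ∣ N
    q∣N = proj₂ (proj₂ (prefix⊆S' (there (here refl))))

    r∣N : r ∣ N
    r∣N = proj₂ (proj₂ (prefix⊆S' (there (there (here refl)))))

    beyond-pq : ∀ {d} → InS' N d → p * q < d → d ∈ rest
    beyond-pq {d} d∈ pq<d = ∈-tail (∈-tail (∈-tail (∈-tail (∈-prefix d∈) p<d) q<d) r<d) pq<d
      where
      r<d : r < d
      r<d = <-trans r<pq pq<d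
      q<d : q < d
      q<d = <-trans q<r r<d
      p<d : p < d
      p<d = <-trans p<q q<d

    ≡p⊎q≤ : ∀ {d} → InS' N d → d ≡ p ⊎ q ≤ d
    ≡p⊎q≤ d∈ with ∈-prefix d∈
    ... | here d≡p = inj₁ d≡p
    ... | there d∈′ = inj₂ (head-≤ (AllPairs.tail sorted) d∈′)

    p²∤N : ¬ p * p ∣ N
    p²∤N p²∣N with ∈-prefix (<-trans 1<p (n<n*n 1<p) , <-trans (*-mono-< p²<pq p²<pq) [pq]²<N , p²∣N)
      where
      p²<pq : p * p < p * q
      p²<pq = *-monoʳ-< p p<q
    ... | here p²≡p = <-irrefl (sym p²≡p) (n<n*n 1<p)
    ... | there (here p²≡q) = ∤-prime q-prime 1<p p<q (divides p (sym p²≡q))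
    ... | there (there (here p²≡r)) = ∤-prime r-prime 1<p p<r (divides p (sym p²≡r))
    ... | there (there (there p²∈)) = <⇒≱ (*-monoʳ-< p p<q) (head-≤ sorted-from-pq p²∈)

    q∣d∧pq<d⇒q²≤d : ∀ {d} → InS' N d → q ∣ d → p * q < d → q * q ≤ d
    q∣d∧pq<d⇒q²≤d (_ , d²<N , d∣N) (divides t refl) pq<tq with ≡p⊎q≤ (1<t , t²<N , ∣-trans (m∣m*n q) d∣N)
      where
      p<t : p < t
      p<t = *-cancelʳ-< q p t pq<tq
      1<t : 1 < t
      1<t = <-trans 1<p p<t
      t≤tq : t ≤ t * q
      t≤tq = m≤m*n t q
      t²<N : t * t < N
      t²<N = ≤-<-trans (*-mono-≤ t≤tq t≤tq) d²<N
    ... | inj₁ refl = contradiction pq<tq (<-irrefl refl)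
    ... | inj₂ q≤t = *-monoˡ-≤ q q≤t

    cofactor-in-range : ∀ M → N ≡ M * q * (p * r) → N ≤ p * r * (p * r) →
                        InS' N (M * q) × q * q ≤ M * q × M * q ≤ p * r
    cofactor-in-range 0 N≡0 _ = contradiction (subst (p * q * (p * q) <_) N≡0 [pq]²<N) λ ()
    cofactor-in-range 1 N≡qpr _ = contradiction (*-cancelˡ-< (p * q) (p * q) r [pq]²<pqr) (<-asym r<pq)
      where
      N≡pqr : N ≡ p * q * r
      N≡pqr = trans N≡qpr (solve (p ∷ q ∷ r ∷ []))
      [pq]²<pqr : p * q * (p * q) < p * q * r
      [pq]²<pqr = subst (p * q * (p * q) <_) N≡pqr [pq]²<N
    cofactor-in-range M@(suc (suc _)) N≡ N≤pr² = Mq∈S' , *-monoˡ-≤ q q≤M , Mq≤pr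
      where
      Mq≤pr : M * q ≤ p * r
      Mq≤pr = *-cancelʳ-≤ (M * q) (p * r) (p * r) {{m*n≢0 p r}} (subst (_≤ p * r * (p * r)) N≡ N≤pr²)
      Mq<pr : M * q < p * r
      Mq<pr = ≤∧≢⇒< Mq≤pr (λ Mq≡pr → q∤pr (divides M (sym Mq≡pr)))
      M∈S' : InS' N M
      M∈S' = subst (λ n → InS' n M) (sym (trans N≡ (*-assoc M q (p * r))))
        (InS'-cofactor (s≤s (s≤s z≤n)) (<-≤-trans (≤-<-trans (m≤m*n M q) Mq<pr) (m≤n*m (p * r) q)))
      q≤M : q ≤ M
      q≤M with ≡p⊎q≤ M∈S'
      ... | inj₁ M≡p = contradiction (divides (q * r) N≡qr*p²) p²∤N
        where
        N≡qr*p² : N ≡ q * r * (p * p)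
        N≡qr*p² = trans N≡ (trans (cong (λ t → t * q * (p * r)) M≡p) (solve (p ∷ q ∷ r ∷ [])))
      ... | inj₂ q≤M = q≤M
      Mq∈S' : InS' N (M * q)
      Mq∈S' = subst (λ n → InS' n (M * q)) (sym N≡)
        (InS'-cofactor (<-≤-trans (s≤s (s≤s z≤n)) (m≤m*n M q)) Mq<pr)

    element-from-q²-to-pr : N ≤ p * r * (p * r) → ∃[ m ] InS' N m × q * q ≤ m × m ≤ p * r
    element-from-q²-to-pr N≤pr² with ∣-prime-product q-prime q∣N q∤pr pr∣N
      where
      pr∣N : p * r ∣ N
      pr∣N = ∣-prime-product r-prime r∣N (>⇒∤ p<r) p∣N
    ... | divides M N≡M*prq =
      M * q , cofactor-in-range M (trans N≡M*prq (solve (M ∷ p ∷ q ∷ r ∷ []))) N≤pr²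

  module _ {a b : ℤ.ℤ} (h₁ : + r ≡ a ℤ.* + q ℤ.+ b ℤ.* + p)
    (h₂ : + (p * q) ≡ a ℤ.* + r ℤ.+ b ℤ.* + q) where

    open PrimeRecurrence q-prime q∤r p<r r≢p² a b h₁ h₂

    no-element-from-q²-to-pr : ∀ N {rest m} → S' N ≡ p ∷ q ∷ r ∷ p * q ∷ rest →
      RecurrentList a b (r ∷ p * q ∷ rest) → InS' N m → q * q ≤ m → m ≤ p * r → ⊥
    no-element-from-q²-to-pr N S'≡ rec m∈ q²≤m m≤pr
      with next-term-≤ rest-sorted rec (beyond-pq m∈ (<-≤-trans pq<q² q²≤m))
      where open Prefix N S'≡
    ... | x₅ , h₃ , x₅≤m = <⇒≱ (fifth-beyond-pr h₃ q²<pr) (≤-trans x₅≤m m≤pr)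
      where
      q²<pr : q * q < p * r
      q²<pr = ≤∧≢⇒< (≤-trans q²≤m m≤pr) q²≢pr

    pr-after-fifth : ∀ N {x₅ rest} → S' N ≡ p ∷ q ∷ r ∷ p * q ∷ x₅ ∷ rest →
      + x₅ ≡ a ℤ.* + (p * q) ℤ.+ b ℤ.* + r → InS' N (p * r) → p * r ∈ rest
    pr-after-fifth N {x₅} {rest} S'≡ h₃ pr∈ = ∈-tail pr∈x₅∷rest x₅<pr
      where
      open Prefix N S'≡
      pr∈x₅∷rest : p * r ∈ x₅ ∷ rest
      pr∈x₅∷rest = beyond-pq pr∈ pq<pr
      x₅<pr : x₅ < p * r
      x₅<pr = ≤∧≢⇒< (head-≤ rest-sorted pr∈x₅∷rest) (fifth-≢-pr h₃ q²≢pr)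

    pr∉S' : ∀ N {rest} → S' N ≡ p ∷ q ∷ r ∷ p * q ∷ rest → RecurrentList a b (r ∷ p * q ∷ rest) →
            ¬ InS' N (p * r)
    pr∉S' N {rest = []} S'≡ _ pr∈ = case Prefix.beyond-pq N S'≡ pr∈ pq<pr of λ ()
    pr∉S' N {rest = x₅ ∷ []} S'≡ (h₃ , _) pr∈ = case pr-after-fifth N S'≡ h₃ pr∈ of λ ()
    pr∉S' N {rest = x₅ ∷ x₆ ∷ _} S'≡ rec@(h₃ , h₄ , _) pr∈ =
      no-element-from-q²-to-pr N S'≡ rec x₆∈ q²≤x₆ x₆≤pr
      where
      open Prefix N S'≡
      x₆∈ : InS' N x₆
      x₆∈ = rest⊆S' (there (here refl))
      q²≤x₆ : q * q ≤ x₆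
      q²≤x₆ = q∣d∧pq<d⇒q²≤d x₆∈ (sixth-divisible h₄) (rest-above-pq (there (here refl)))
      x₆≤pr : x₆ ≤ p * r
      x₆≤pr = head-≤ (AllPairs.tail rest-sorted) (pr-after-fifth N S'≡ h₃ pr∈)

    N≤[pr]² : ∀ N {rest} → S' N ≡ p ∷ q ∷ r ∷ p * q ∷ rest → RecurrentList a b (r ∷ p * q ∷ rest) →
              N ≤ p * r * (p * r)
    N≤[pr]² N S'≡ rec = ≮⇒≥ λ [pr]²<N → pr∉S' N S'≡ rec (1<pr , [pr]²<N , pr∣N)
      where
      open Prefix N S'≡
      1<pr : 1 < p * r
      1<pr = <-trans 1<p (m<m*n p r (prime>1 r-prime))
      pr∣N : p * r ∣ N
      pr∣N = ∣-prime-product r-prime r∣N (>⇒∤ p<r) p∣N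

proposition3p5 : (p q r : ℕ) → Prime p → Prime q → Prime r → p < q → q < r →
    ¬ (∃[ N ] (1 < N × SmallRecurrent N × (∃[ rest ] S' N ≡ p ∷ q ∷ r ∷ p * q ∷ rest)))
proposition3p5 p q r p-prime q-prime r-prime p<q q<r (N , _ , (a , b , rec) , rest , S'≡)
  with subst (RecurrentList a b) S'≡ rec
... | h₁ , h₂ , rec₃ =
  let m , m∈ , q²≤m , m≤pr = Prefix.element-from-q²-to-pr N S'≡ (N≤[pr]² h₁ h₂ N S'≡ rec₃)
  in no-element-from-q²-to-pr h₁ h₂ N S'≡ rec₃ m∈ q²≤m m≤pr
  where open Primes p-prime q-prime r-prime p<q q<r
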